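{- Let $K$ be a simplicial complex of dimension $d$ on the vertex set $V$ and let $v\in V$. Then \[\mathrm{st}_{\Delta_d(K)}(v)=\Delta_d\big(\Gamma_K(v)\big).\]
   Context: For a finite set $S$ and integer $j\ge1$, $[S]_j$ denotes the collection of all subsets of $S$ of size at most $j$. For a simplicial complex $L$ on vertex set $V$ and a vertex $v$, the star is $\mathrm{st}_L(v)=\{S\subset V: S\cup\{v\}\in L\}$. For $K$ of dimension $d$, the neighborhood complex of $v$ is $\Gamma_K(v)=\mathrm{st}_K(v)\cup\{S\subset V\setminus\{v\}: S\in K,\ |S|=d+1,\ [S]_d\subset\mathrm{st}_K(v)\}$ (note the dependence on $d=\dim K$). For a simplicial complex $L$ on vertices in $V$ with $\dim L\le d$, the $d$-completion is $\Delta_d(L)=L\cup\{S\subset V: |S|\geq d+2,\ [S]_{d+1}\subset L\}$, with $\Delta_d(\emptyset)=\emptyset$. -}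

module Defs where

open import Data.Nat using (ℕ; suc; _≤_)
open import Data.Fin using (Fin)
open import Data.Fin.Subset using (Subset; _⊆_; _∪_; ⁅_⁆; _∉_; ∣_∣)
open import Data.Product using (_×_; ∃)
open import Data.Sum using (_⊎_)
open import Relation.Binary.PropositionalEquality using (_≡_)
open import Function.Bundles using (_⇔_)

Family : ℕ → Set₁
Family n = Subset n → Set

IsComplex : ∀ {n} → Family n → Set
IsComplex {n} K = ∀ (S T : Subset n) → T ⊆ S → K S → K T

HasDim : ∀ {n} → Family n → ℕ → Set
HasDim {n} K d = (∃ λ (S : Subset n) → K S × ∣ S ∣ ≡ suc d)
               × (∀ (S : Subset n) → K S → ∣ S ∣ ≤ suc d)

-- [S]_j ⊂ L : every subset of S of size at most j lies in L.
SubsetsUpTo⊂ : ∀ {n} → ℕ → Subset n → Family n → Set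
SubsetsUpTo⊂ {n} j S L = ∀ (T : Subset n) → T ⊆ S → ∣ T ∣ ≤ j → L T

star : ∀ {n} → Family n → Fin n → Family n
star L v S = L (S ∪ ⁅ v ⁆)

-- neighborhood complex Γ_K(v), where d = dim K is passed explicitly
Γ : ∀ {n} → Family n → ℕ → Fin n → Family n
Γ K d v S = star K v S
          ⊎ (v ∉ S × K S × ∣ S ∣ ≡ suc d × SubsetsUpTo⊂ d S (star K v))

Δ : ∀ {n} → ℕ → Family n → Family n
Δ d L S = L S ⊎ (suc (suc d) ≤ ∣ S ∣ × SubsetsUpTo⊂ (suc d) S L)

_≐_ : ∀ {n} → Family n → Family n → Set
_≐_ {n} A B = ∀ (S : Subset n) → A S ⇔ B S
infix 4 _≐_

-- A set S ∪ {v} has all its (≤ d+1)-subsets in K exactly when S has all its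
-- (≤ d+1)-subsets in Γ_K(v): both say that [S]_d ⊂ st_K(v) and [S]_{d+1} ⊂ K.
-- Hence the "large" faces of Δ_d(K) through v and of Δ_d(Γ_K(v)) correspond.
-- The only other faces are those of K itself, and a face S ∪ {v} of Δ_d(K)
-- that is not large on the Γ side has v ∉ S and |S| = d+1, which is precisely
-- a top-dimensional face of Γ_K(v) outside st_K(v).
module Submission where

open import Defs
open import Data.Nat using (ℕ; suc; _≤_; _<_; _+_; z≤n; s≤s; _≤?_)
open import Data.Nat.Properties
open import Data.Fin using (Fin)
import Data.Fin as Fin
open import Data.Fin.Subset using (Subset; _∪_; _─_; _-_; ⁅_⁆; _∈_; _∉_; _⊆_; ∣_∣; inside; outside)
open import Data.Fin.Subset.Properties
open import Data.Vec using (_∷_; [])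
open import Data.Vec.Base using (here; there)
open import Data.Product using (_,_)
open import Data.Sum using (inj₁; inj₂; [_,_])
open import Relation.Nullary using (yes; no; contradiction)
open import Relation.Binary.PropositionalEquality using (_≡_; sym; trans; cong; subst)
open import Function.Bundles using (mk⇔)

private
  variable
    n : ℕ

∣p∪q∣≤∣p∣+∣q∣ : ∀ (p q : Subset n) → ∣ p ∪ q ∣ ≤ ∣ p ∣ + ∣ q ∣
∣p∪q∣≤∣p∣+∣q∣ [] [] = z≤n
∣p∪q∣≤∣p∣+∣q∣ (outside ∷ p) (outside ∷ q) = ∣p∪q∣≤∣p∣+∣q∣ p q
∣p∪q∣≤∣p∣+∣q∣ (outside ∷ p) (inside ∷ q) =
  ≤-trans (s≤s (∣p∪q∣≤∣p∣+∣q∣ p q)) (≤-reflexive (sym (+-suc ∣ p ∣ ∣ q ∣)))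
∣p∪q∣≤∣p∣+∣q∣ (inside ∷ p) (outside ∷ q) = s≤s (∣p∪q∣≤∣p∣+∣q∣ p q)
∣p∪q∣≤∣p∣+∣q∣ (inside ∷ p) (inside ∷ q) =
  s≤s (≤-trans (∣p∪q∣≤∣p∣+∣q∣ p q) (≤-trans (n≤1+n _) (≤-reflexive (sym (+-suc ∣ p ∣ ∣ q ∣)))))

∣p∪⁅x⁆∣≤1+∣p∣ : ∀ (p : Subset n) (x : Fin n) → ∣ p ∪ ⁅ x ⁆ ∣ ≤ suc ∣ p ∣
∣p∪⁅x⁆∣≤1+∣p∣ p x = ≤-trans (∣p∪q∣≤∣p∣+∣q∣ p ⁅ x ⁆)
  (≤-reflexive (trans (cong (∣ p ∣ +_) (∣⁅x⁆∣≡1 x)) (+-comm ∣ p ∣ 1)))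

x∉p⇒∣p∣<∣p∪⁅x⁆∣ : ∀ {p : Subset n} {x : Fin n} → x ∉ p → ∣ p ∣ < ∣ p ∪ ⁅ x ⁆ ∣
x∉p⇒∣p∣<∣p∪⁅x⁆∣ {x = x} x∉p =
  p⊂q⇒∣p∣<∣q∣ (p⊆p∪q ⁅ x ⁆ , x , x∈p∪q⁺ (inj₂ (x∈⁅x⁆ x)) , x∉p)

x∈p─q⇒x∉q : ∀ {x : Fin n} (p q : Subset n) → x ∈ p ─ q → x ∉ q
x∈p─q⇒x∉q (_ ∷ p) (inside ∷ q) () here
x∈p─q⇒x∉q (_ ∷ p) (_ ∷ q) (there x∈p─q) (there x∈q) = x∈p─q⇒x∉q p q x∈p─q x∈q

∪-monoˡ-⊆ : ∀ {p q : Subset n} (r : Subset n) → p ⊆ q → p ∪ r ⊆ q ∪ r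
∪-monoˡ-⊆ {p = p} r p⊆q y∈p∪r =
  x∈p∪q⁺ ([ (λ y∈p → inj₁ (p⊆q y∈p)) , inj₂ ] (x∈p∪q⁻ p r y∈p∪r))

x∈p⇒p∪⁅x⁆⊆p : ∀ {p : Subset n} {x : Fin n} → x ∈ p → p ∪ ⁅ x ⁆ ⊆ p
x∈p⇒p∪⁅x⁆⊆p {p = p} {x = x} x∈p y∈p∪⁅x⁆ =
  [ (λ y∈p → y∈p) , (λ y∈⁅x⁆ → subst (_∈ p) (sym (x∈⁅y⁆⇒x≡y x y∈⁅x⁆)) x∈p) ]
    (x∈p∪q⁻ p ⁅ x ⁆ y∈p∪⁅x⁆)

p⊆p-x∪⁅x⁆ : ∀ (p : Subset n) (x : Fin n) → p ⊆ (p - x) ∪ ⁅ x ⁆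
p⊆p-x∪⁅x⁆ p x {y} y∈p with y Fin.≟ x
... | yes y≡x = x∈p∪q⁺ (inj₂ (subst (_∈ ⁅ x ⁆) (sym y≡x) (x∈⁅x⁆ x)))
... | no y≢x = x∈p∪q⁺ (inj₁ (x∈p∧x≢y⇒x∈p-y y∈p y≢x))

p⊆q∪⁅x⁆⇒p-x⊆q : ∀ {p q : Subset n} {x : Fin n} → p ⊆ q ∪ ⁅ x ⁆ → p - x ⊆ q
p⊆q∪⁅x⁆⇒p-x⊆q {p = p} {q = q} {x = x} p⊆q∪⁅x⁆ y∈p-x =
  [ (λ y∈q → y∈q) , (λ y∈⁅x⁆ → contradiction y∈⁅x⁆ (x∈p─q⇒x∉q p ⁅ x ⁆ y∈p-x)) ]
    (x∈p∪q⁻ q ⁅ x ⁆ (p⊆q∪⁅x⁆ (p─q⊆p p ⁅ x ⁆ y∈p-x)))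

p⊆q∪⁅x⁆∧x∉p⇒p⊆q : ∀ {p q : Subset n} {x : Fin n} → p ⊆ q ∪ ⁅ x ⁆ → x ∉ p → p ⊆ q
p⊆q∪⁅x⁆∧x∉p⇒p⊆q {p = p} {q = q} {x = x} p⊆q∪⁅x⁆ x∉p {y} y∈p =
  [ (λ y∈q → y∈q) , (λ y∈⁅x⁆ → contradiction (subst (_∈ p) (x∈⁅y⁆⇒x≡y x y∈⁅x⁆) y∈p) x∉p) ]
    (x∈p∪q⁻ q ⁅ x ⁆ (p⊆q∪⁅x⁆ y∈p))

SubsetsUpTo⊂-anti : ∀ {j} {S T : Subset n} {L : Family n}
                  → T ⊆ S → SubsetsUpTo⊂ j S L → SubsetsUpTo⊂ j T L
SubsetsUpTo⊂-anti T⊆S S-ok U U⊆T = S-ok U (⊆-trans U⊆T T⊆S)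

module _ {K : Family n} (K-complex : IsComplex K) (d : ℕ) (v : Fin n) where

  star⇒face : ∀ {S : Subset n} → star K v S → K S
  star⇒face {S} = K-complex (S ∪ ⁅ v ⁆) S (p⊆p∪q ⁅ v ⁆)

  Γ⇒face : ∀ {S : Subset n} → Γ K d v S → K S
  Γ⇒face (inj₁ S∈st) = star⇒face S∈st
  Γ⇒face (inj₂ (_ , S∈K , _)) = S∈K

  Γ-small⇒star : ∀ {S : Subset n} → ∣ S ∣ ≤ d → Γ K d v S → star K v S
  Γ-small⇒star _ (inj₁ S∈st) = S∈st
  Γ-small⇒star ∣S∣≤d (inj₂ (_ , _ , ∣S∣≡1+d , _)) =
    contradiction (≤-trans (≤-reflexive (sym ∣S∣≡1+d)) ∣S∣≤d) 1+n≰n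

  upTo-∪⁅v⁆⇒upTo-star : ∀ {S : Subset n}
    → SubsetsUpTo⊂ (suc d) (S ∪ ⁅ v ⁆) K → SubsetsUpTo⊂ d S (star K v)
  upTo-∪⁅v⁆⇒upTo-star S∪v-ok T T⊆S ∣T∣≤d =
    S∪v-ok (T ∪ ⁅ v ⁆) (∪-monoˡ-⊆ ⁅ v ⁆ T⊆S) (≤-trans (∣p∪⁅x⁆∣≤1+∣p∣ T v) (s≤s ∣T∣≤d))

  upTo-star∧upTo⇒upTo-∪⁅v⁆ : ∀ {S : Subset n}
    → SubsetsUpTo⊂ d S (star K v) → SubsetsUpTo⊂ (suc d) S K
    → SubsetsUpTo⊂ (suc d) (S ∪ ⁅ v ⁆) K
  upTo-star∧upTo⇒upTo-∪⁅v⁆ S-star S-ok T T⊆S∪v ∣T∣≤1+d with v ∈? T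
  ... | yes v∈T = K-complex _ T (p⊆p-x∪⁅x⁆ T v)
        (S-star (T - v) (p⊆q∪⁅x⁆⇒p-x⊆q T⊆S∪v) (≤-pred (≤-trans (x∈p⇒∣p-x∣<∣p∣ v∈T) ∣T∣≤1+d)))
  ... | no v∉T = S-ok T (p⊆q∪⁅x⁆∧x∉p⇒p⊆q T⊆S∪v v∉T) ∣T∣≤1+d

  upTo-star∧upTo⇒upTo-Γ : ∀ {S : Subset n}
    → SubsetsUpTo⊂ d S (star K v) → SubsetsUpTo⊂ (suc d) S K
    → SubsetsUpTo⊂ (suc d) S (Γ K d v)
  upTo-star∧upTo⇒upTo-Γ S-star S-ok T T⊆S ∣T∣≤1+d with m≤n⇒m<n∨m≡n ∣T∣≤1+d
  ... | inj₁ ∣T∣<1+d = inj₁ (S-star T T⊆S (≤-pred ∣T∣<1+d))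
  ... | inj₂ ∣T∣≡1+d with v ∈? T
  ...   | yes v∈T = inj₁ (K-complex T (T ∪ ⁅ v ⁆) (x∈p⇒p∪⁅x⁆⊆p v∈T) (S-ok T T⊆S ∣T∣≤1+d))
  ...   | no v∉T = inj₂ (v∉T , S-ok T T⊆S ∣T∣≤1+d , ∣T∣≡1+d , SubsetsUpTo⊂-anti T⊆S S-star)

  upTo-∪⁅v⁆⇒upTo-Γ : ∀ {S : Subset n}
    → SubsetsUpTo⊂ (suc d) (S ∪ ⁅ v ⁆) K → SubsetsUpTo⊂ (suc d) S (Γ K d v)
  upTo-∪⁅v⁆⇒upTo-Γ S∪v-ok = upTo-star∧upTo⇒upTo-Γ
    (upTo-∪⁅v⁆⇒upTo-star S∪v-ok) (SubsetsUpTo⊂-anti (p⊆p∪q ⁅ v ⁆) S∪v-ok)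

  upTo-Γ⇒upTo-∪⁅v⁆ : ∀ {S : Subset n}
    → SubsetsUpTo⊂ (suc d) S (Γ K d v) → SubsetsUpTo⊂ (suc d) (S ∪ ⁅ v ⁆) K
  upTo-Γ⇒upTo-∪⁅v⁆ S-ok = upTo-star∧upTo⇒upTo-∪⁅v⁆
    (λ T T⊆S ∣T∣≤d → Γ-small⇒star ∣T∣≤d (S-ok T T⊆S (m≤n⇒m≤1+n ∣T∣≤d)))
    (λ T T⊆S ∣T∣≤1+d → Γ⇒face (S-ok T T⊆S ∣T∣≤1+d))

  star-Δ⊆Δ-Γ : ∀ (S : Subset n) → star (Δ d K) v S → Δ d (Γ K d v) S
  star-Δ⊆Δ-Γ S (inj₁ S∪v∈K) = inj₁ (inj₁ S∪v∈K)
  star-Δ⊆Δ-Γ S (inj₂ (2+d≤∣S∪v∣ , S∪v-ok)) with suc (suc d) ≤? ∣ S ∣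
  ... | yes 2+d≤∣S∣ = inj₂ (2+d≤∣S∣ , upTo-∪⁅v⁆⇒upTo-Γ S∪v-ok)
  ... | no 2+d≰∣S∣ = inj₁ (inj₂ (v∉S , S∪v-ok S (p⊆p∪q ⁅ v ⁆) (≤-reflexive ∣S∣≡1+d) , ∣S∣≡1+d
                                , upTo-∪⁅v⁆⇒upTo-star S∪v-ok))
    where
    v∉S : v ∉ S
    v∉S v∈S = 2+d≰∣S∣ (≤-trans 2+d≤∣S∪v∣ (p⊆q⇒∣p∣≤∣q∣ (x∈p⇒p∪⁅x⁆⊆p v∈S)))
    ∣S∣≡1+d : ∣ S ∣ ≡ suc d
    ∣S∣≡1+d = ≤-antisym (≤-pred (≰⇒> 2+d≰∣S∣)) (≤-pred (≤-trans 2+d≤∣S∪v∣ (∣p∪⁅x⁆∣≤1+∣p∣ S v)))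

  Δ-Γ⊆star-Δ : ∀ (S : Subset n) → Δ d (Γ K d v) S → star (Δ d K) v S
  Δ-Γ⊆star-Δ S (inj₁ (inj₁ S∪v∈K)) = inj₁ S∪v∈K
  Δ-Γ⊆star-Δ S (inj₁ (inj₂ (v∉S , S∈K , ∣S∣≡1+d , S-star))) =
    inj₂ ( ≤-trans (≤-reflexive (cong suc (sym ∣S∣≡1+d))) (x∉p⇒∣p∣<∣p∪⁅x⁆∣ v∉S)
         , upTo-star∧upTo⇒upTo-∪⁅v⁆ S-star (λ T T⊆S _ → K-complex S T T⊆S S∈K))
  Δ-Γ⊆star-Δ S (inj₂ (2+d≤∣S∣ , S-ok)) =
    inj₂ (≤-trans 2+d≤∣S∣ (∣p∣≤∣p∪q∣ S ⁅ v ⁆) , upTo-Γ⇒upTo-∪⁅v⁆ S-ok)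

proposition4p2 : ∀ (n : ℕ) (K : Family n) (d : ℕ) (v : Fin n)
    → IsComplex K → HasDim K d
    → star (Δ d K) v ≐ Δ d (Γ K d v)
proposition4p2 n K d v K-complex _ S =
  mk⇔ (star-Δ⊆Δ-Γ K-complex d v S) (Δ-Γ⊆star-Δ K-complex d v S)
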